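{- Let $s\ge 2$ and $t$ be integers, let $g=\frac{s-1}{\gcd(s-1,t)}$, and let $\bar g$ be the product of the distinct primes dividing $g$ ($\bar g=1$ if $g=1$). Suppose $r$ is distinguished with respect to $(s,t)$ and $b$ is an integer with $\gcd(b,\bar g s)=1$. Then every positive integer $r'$ with $r'\equiv br\pmod{\bar g r s}$ is distinguished with respect to $(s,t)$.
   Context: For integers $s$ and $r\ge 1$ with $\gcd(r,s)=1$, $\operatorname{ord}_r(s)$ denotes the least positive integer $m$ with $s^m\equiv 1\pmod r$. For integers $s\ge 2$ and $t$, an integer $r\ge 2$ is distinguished with respect to $(s,t)$ if $\gcd(r,s)=1$ and $r$ divides $t\cdot\frac{s^{\operatorname{ord}_r(s)}-1}{s-1}$. -}

module Defs where

open import Data.Nat using (ℕ; zero; suc; _∸_; _^_; _*_; _≤_; _<_; NonZero; ≢-nonZero; _/_; s≤s; z≤n)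
open import Data.Nat.Divisibility using (_∣_; _∣?_)
open import Data.Nat.Coprimality using (Coprime)
open import Data.Nat.Primality using (Prime; prime?)
open import Data.Nat.GCD using (gcd; gcd[m,n]≢0)
open import Data.List using (List; filter; upTo)
open import Data.Nat.ListAction using (product)
open import Data.Product using (_×_; ∃; ∃-syntax)
open import Data.Sum using (inj₁)
open import Data.Integer as ℤ using (ℤ; +_; ∣_∣)
import Data.Integer.Divisibility as ℤD
open import Relation.Nullary using (¬_)
open import Relation.Nullary.Decidable using (_×-dec_)

s∸1-nonZero : ∀ {s} → 2 ≤ s → NonZero (s ∸ 1)
s∸1-nonZero (s≤s (s≤s _)) = _

-- IsOrd r s m : m = ord_r(s), the least positive m with s^m ≡ 1 (mod r).
-- (For s ≥ 1, s^m ≥ 1, so "s^m ≡ 1 mod r" is "r ∣ s^m ∸ 1".)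
IsOrd : ℕ → ℕ → ℕ → Set
IsOrd r s m = (1 ≤ m) × (r ∣ (s ^ m ∸ 1)) × (∀ k → 1 ≤ k → k < m → ¬ (r ∣ (s ^ k ∸ 1)))

repQuot : (s : ℕ) → 2 ≤ s → ℕ → ℕ
repQuot s h m = (s ^ m ∸ 1) / (s ∸ 1)
  where instance _ = s∸1-nonZero h

Distinguished : (s : ℕ) → 2 ≤ s → ℤ → ℕ → Set
Distinguished s h t r =
  (2 ≤ r) × Coprime r s ×
  ∃[ m ] (IsOrd r s m × ((+ r) ℤD.∣ (t ℤ.* (+ repQuot s h m))))

gOf : (s : ℕ) → 2 ≤ s → ℤ → ℕ
gOf (suc (suc k)) (s≤s (s≤s _)) t = suc k / gcd (suc k) ∣ t ∣
  where instance _ = ≢-nonZero (gcd[m,n]≢0 (suc k) ∣ t ∣ (inj₁ (λ ())))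

rad : ℕ → ℕ
rad n = product (filter (λ p → prime? p ×-dec (p ∣? n)) (upTo (suc n)))

-- Write r′ = c·r: the congruence r′ ≡ b·r (mod ḡ·r·s) forces r ∣ r′ and c ≡ b (mod ḡ·s), so c is
-- prime to s and to ḡ, hence to g. With m = ord_r(s) and m′ = ord_{r′}(s) we have m ∣ m′, so
-- q_m = (s^m − 1)/(s − 1) divides q_{m′} and r ∣ t·q_{m′}. On the other hand
-- r′ ∣ s^{m′} − 1 = (s − 1)·q_{m′}, which divides g·t·q_{m′} because s − 1 = g·gcd(s − 1, t).
-- Since c is prime to g, the two divisibilities combine to r′ = c·r ∣ t·q_{m′}.
module Submission where

open import Defs
open import Data.Nat
open import Data.Nat.Properties
open import Data.Nat.Induction using (<-rec)
open import Data.Nat.Divisibility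
open import Data.Nat.DivMod using (m≡m%n+[m/n]*n; m%n<n; m/n*n≡m; m≥n⇒m/n>0)
open import Data.Nat.GCD using (gcd; gcd[m,n]∣m; gcd[m,n]∣n; gcd[m,n]≢0)
open import Data.Nat.Coprimality as Coprime using (Coprime; coprime-divisor)
open import Data.Nat.Primality using (Prime; prime?; ¬prime[1])
open import Data.Nat.Primality.Factorisation using (factorise)
open import Data.Nat.ListAction.Properties using (∈⇒∣product)
open import Data.Nat.Solver using (module +-*-Solver)
open import Data.Integer as ℤ using (ℤ; +_; ∣_∣; _-_)
open import Data.Integer.Divisibility as ℤD using ()
import Data.Integer.Properties as ℤ
import Data.Integer.Divisibility.Signed as ℤ±
open import Data.Fin using (toℕ; fromℕ<)
open import Data.Fin.Properties using (pigeonhole; toℕ-fromℕ<)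
open import Data.List using ([]; _∷_)
open import Data.List.Relation.Unary.All using (_∷_)
open import Data.List.Relation.Unary.Any using (here)
open import Data.List.Membership.Propositional.Properties using (∈-filter⁺; ∈-upTo⁺)
open import Data.Product using (_×_; _,_; proj₁; proj₂; ∃-syntax)
open import Data.Sum using (inj₁)
open import Relation.Nullary using (¬_; yes; no; contradiction)
open import Relation.Nullary.Decidable using (_×-dec_; decidable-stable)
open import Relation.Unary using (Pred; Decidable)
open import Relation.Binary.PropositionalEquality
open +-*-Solver using (solve; _:*_; _:=_)
open import Algebra.Properties.CommutativeSemigroup *-commutativeSemigroup using (xy∙z≈xz∙y)

s^[m+n]∸s^m≡s^m*[s^n∸1] : ∀ s m n → s ^ (m + n) ∸ s ^ m ≡ s ^ m * (s ^ n ∸ 1)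
s^[m+n]∸s^m≡s^m*[s^n∸1] s m n = begin
  s ^ (m + n) ∸ s ^ m       ≡⟨ cong₂ _∸_ (sym (^-distribˡ-+-* s m n)) (*-identityʳ (s ^ m)) ⟨
  s ^ m * s ^ n ∸ s ^ m * 1 ≡⟨ *-distribˡ-∸ (s ^ m) (s ^ n) 1 ⟨
  s ^ m * (s ^ n ∸ 1)       ∎
  where open ≡-Reasoning

s^[m+n]∸1≡s^m*[s^n∸1]+[s^m∸1] : ∀ s .{{_ : NonZero s}} m n →
  s ^ (m + n) ∸ 1 ≡ s ^ m * (s ^ n ∸ 1) + (s ^ m ∸ 1)
s^[m+n]∸1≡s^m*[s^n∸1]+[s^m∸1] s m n = begin
  s ^ (m + n) ∸ 1                         ≡⟨ cong (_∸ 1) (m∸n+n≡m s^m≤s^[m+n]) ⟨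
  (s ^ (m + n) ∸ s ^ m) + s ^ m ∸ 1       ≡⟨ +-∸-assoc (s ^ (m + n) ∸ s ^ m) (m^n>0 s m) ⟩
  (s ^ (m + n) ∸ s ^ m) + (s ^ m ∸ 1)     ≡⟨ cong (_+ (s ^ m ∸ 1)) (s^[m+n]∸s^m≡s^m*[s^n∸1] s m n) ⟩
  s ^ m * (s ^ n ∸ 1) + (s ^ m ∸ 1)       ∎
  where
  open ≡-Reasoning
  s^m≤s^[m+n] : s ^ m ≤ s ^ (m + n)
  s^m≤s^[m+n] = ^-monoʳ-≤ s (m≤m+n m n)

^∸1-mono-∣ : ∀ s .{{_ : NonZero s}} {m n} → m ∣ n → s ^ m ∸ 1 ∣ s ^ n ∸ 1
^∸1-mono-∣ s {m} (divides q refl) = multiple q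
  where
  multiple : ∀ q → s ^ m ∸ 1 ∣ s ^ (q * m) ∸ 1
  multiple zero    = _ ∣0
  multiple (suc q) rewrite s^[m+n]∸1≡s^m*[s^n∸1]+[s^m∸1] s m (q * m) =
    ∣m∣n⇒∣m+n (∣n⇒∣m*n (s ^ m) (multiple q)) ∣-refl

IsOrd⇒∣ : ∀ {r s m n} .{{_ : NonZero s}} → IsOrd r s m → r ∣ s ^ n ∸ 1 → m ∣ n
IsOrd⇒∣ {r} {s} {m} {n} (1≤m , r∣s^m∸1 , minimal) r∣s^n∸1 = m%n≡0⇒n∣m n m n%m≡0
  where
  instance _ = >-nonZero 1≤m
  split : s ^ n ∸ 1 ≡ s ^ (n % m) * (s ^ (n / m * m) ∸ 1) + (s ^ (n % m) ∸ 1)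
  split = trans (cong (λ k → s ^ k ∸ 1) (m≡m%n+[m/n]*n n m))
                (s^[m+n]∸1≡s^m*[s^n∸1]+[s^m∸1] s (n % m) (n / m * m))
  r∣s^[n%m]∸1 : r ∣ s ^ (n % m) ∸ 1
  r∣s^[n%m]∸1 = ∣m+n∣m⇒∣n (subst (r ∣_) split r∣s^n∸1)
    (∣n⇒∣m*n (s ^ (n % m)) (∣-trans r∣s^m∸1 (^∸1-mono-∣ s (n∣m*n (n / m)))))
  n%m≡0 : n % m ≡ 0
  n%m≡0 = decidable-stable (n % m ≟ 0)
    λ n%m≢0 → minimal (n % m) (n≢0⇒n>0 n%m≢0) (m%n<n n m) r∣s^[n%m]∸1

coprime-* : ∀ {a x y} → Coprime a x → Coprime a y → Coprime a (x * y)
coprime-* {x = x} a⊥x a⊥y (d∣a , d∣xy) = a⊥y (d∣a , coprime-divisor d⊥x d∣xy)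
  where
  d⊥x : Coprime _ x
  d⊥x (e∣d , e∣x) = a⊥x (∣-trans e∣d d∣a , e∣x)

coprime-^ : ∀ {a s} → Coprime a s → ∀ n → Coprime a (s ^ n)
coprime-^ a⊥s zero    (_ , d∣1) = ∣1⇒≡1 d∣1
coprime-^ a⊥s (suc n) = coprime-* a⊥s (coprime-^ a⊥s n)

coprime-*⁻¹ : ∀ {a x y} → Coprime a (x * y) → Coprime a x × Coprime a y
coprime-*⁻¹ {x = x} {y} a⊥xy = (λ (d∣a , d∣x) → a⊥xy (d∣a , ∣m⇒∣m*n y d∣x))
                             , (λ (d∣a , d∣y) → a⊥xy (d∣a , ∣n⇒∣m*n x d∣y))

m%n≡o%n⇒n∣o∸m : ∀ m o n .{{_ : NonZero n}} → m % n ≡ o % n → n ∣ o ∸ m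
m%n≡o%n⇒n∣o∸m m o n eq = divides (o / n ∸ m / n) (begin
  o ∸ m                                  ≡⟨ cong₂ _∸_ (m≡m%n+[m/n]*n o n)
                                                      (trans (m≡m%n+[m/n]*n m n) (cong (_+ m / n * n) eq)) ⟩
  (o % n + o / n * n) ∸ (o % n + m / n * n) ≡⟨ [m+n]∸[m+o]≡n∸o (o % n) (o / n * n) (m / n * n) ⟩
  o / n * n ∸ m / n * n                  ≡⟨ *-distribʳ-∸ n (o / n) (m / n) ⟨
  (o / n ∸ m / n) * n                    ∎)
  where open ≡-Reasoning

-- Pigeonhole on the residues of s⁰, …, sʳ modulo r, then cancel a power of s.
coprime⇒∃r∣s^k∸1 : ∀ {r s} .{{_ : NonZero r}} → Coprime r s → ∃[ k ] (1 ≤ k × r ∣ s ^ k ∸ 1)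
coprime⇒∃r∣s^k∸1 {r} {s} r⊥s
  with i , j , i<j , same-residue ← pigeonhole (n<1+n r) (λ i → fromℕ< (m%n<n (s ^ toℕ i) r))
  = toℕ j ∸ toℕ i , m<n⇒0<n∸m i<j , coprime-divisor (coprime-^ r⊥s (toℕ i)) r∣s^i*[s^[j∸i]∸1]
  where
  r∣s^i*[s^[j∸i]∸1] : r ∣ s ^ toℕ i * (s ^ (toℕ j ∸ toℕ i) ∸ 1)
  r∣s^i*[s^[j∸i]∸1] = subst (r ∣_)
    (trans (cong (λ k → s ^ k ∸ s ^ toℕ i) (sym (m+[n∸m]≡n (<⇒≤ i<j))))
           (s^[m+n]∸s^m≡s^m*[s^n∸1] s (toℕ i) (toℕ j ∸ toℕ i)))
    (m%n≡o%n⇒n∣o∸m (s ^ toℕ i) (s ^ toℕ j) r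
      (trans (sym (toℕ-fromℕ< _)) (trans (cong toℕ same-residue) (toℕ-fromℕ< _))))

module _ {p} {P : Pred ℕ p} (P? : Decidable P) where

  LeastPositive : Set p
  LeastPositive = ∃[ m ] (1 ≤ m × P m × (∀ j → 1 ≤ j → j < m → ¬ P j))

  least-positive : ∀ {k} → 1 ≤ k → P k → LeastPositive
  least-positive {k} = <-rec (λ k → 1 ≤ k → P k → LeastPositive) step k
    where
    step : ∀ k → (∀ {j} → j < k → 1 ≤ j → P j → LeastPositive) → 1 ≤ k → P k → LeastPositive
    step k smaller 1≤k Pk with anyUpTo? (λ j → 1 ≤? j ×-dec P? j) k
    ... | yes (j , j<k , 1≤j , Pj) = smaller j<k 1≤j Pj
    ... | no none = k , 1≤k , Pk , λ j 1≤j j<k Pj → none (j , j<k , 1≤j , Pj)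

IsOrd-exists : ∀ {r s} .{{_ : NonZero r}} → Coprime r s → ∃[ m ] IsOrd r s m
IsOrd-exists {r} {s} r⊥s with k , 1≤k , r∣s^k∸1 ← coprime⇒∃r∣s^k∸1 r⊥s =
  least-positive (λ k → r ∣? s ^ k ∸ 1) 1≤k r∣s^k∸1

repQuot*[s∸1]≡s^n∸1 : ∀ {s} (h : 2 ≤ s) n → repQuot s h n * (s ∸ 1) ≡ s ^ n ∸ 1
repQuot*[s∸1]≡s^n∸1 {s} h n = m/n*n≡m {{s∸1-nonZero h}} s∸1∣s^n∸1
  where
  instance _ = >-nonZero (<-trans z<s h)
  s∸1∣s^n∸1 : s ∸ 1 ∣ s ^ n ∸ 1
  s∸1∣s^n∸1 = subst (λ x → x ∸ 1 ∣ s ^ n ∸ 1) (*-identityʳ s) (^∸1-mono-∣ s (1∣ n))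

repQuot-mono-∣ : ∀ {s} (h : 2 ≤ s) {m n} → m ∣ n → repQuot s h m ∣ repQuot s h n
repQuot-mono-∣ {s} h {m} {n} m∣n = *-cancelʳ-∣ (s ∸ 1) {{s∸1-nonZero h}}
  (subst₂ _∣_ (sym (repQuot*[s∸1]≡s^n∸1 h m)) (sym (repQuot*[s∸1]≡s^n∸1 h n)) (^∸1-mono-∣ s m∣n))
  where instance _ = >-nonZero (<-trans z<s h)

gOf-nonZero : ∀ {s} (h : 2 ≤ s) t → NonZero (gOf s h t)
gOf-nonZero {suc (suc k)} (s≤s (s≤s z≤n)) t =
  >-nonZero (m≥n⇒m/n>0 {{≢-nonZero (gcd[m,n]≢0 (suc k) ∣ t ∣ (inj₁ (λ ())))}} (∣⇒≤ (gcd[m,n]∣m (suc k) ∣ t ∣)))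

-- With d = gcd(s-1,t), both g·d = s-1 and d ∣ t, so g·t·q = (t/d)·q·(s-1).
s^n∸1∣gOf*[∣t∣*repQuot] : ∀ {s} (h : 2 ≤ s) t n → s ^ n ∸ 1 ∣ gOf s h t * (∣ t ∣ * repQuot s h n)
s^n∸1∣gOf*[∣t∣*repQuot] {s@(suc (suc k))} h@(s≤s (s≤s z≤n)) t n = divides t′ (begin
  g * (T * q)              ≡⟨ cong (λ x → g * (x * q)) (m∣n⇒n≡quotient*m d∣T) ⟩
  g * (t′ * d * q)         ≡⟨ solve 4 (λ g t′ d q → g :* (t′ :* d :* q) := t′ :* (q :* (g :* d))) refl g t′ d q ⟩
  t′ * (q * (g * d))       ≡⟨ cong (λ x → t′ * (q * x)) (m/n*n≡m (gcd[m,n]∣m (suc k) T)) ⟩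
  t′ * (q * suc k)         ≡⟨ cong (t′ *_) (repQuot*[s∸1]≡s^n∸1 h n) ⟩
  t′ * (s ^ n ∸ 1)         ∎)
  where
  open ≡-Reasoning
  T = ∣ t ∣
  d = gcd (suc k) T
  instance _ = ≢-nonZero (gcd[m,n]≢0 (suc k) T (inj₁ (λ ())))
  g = gOf s h t
  q = repQuot s h n
  d∣T : d ∣ T
  d∣T = gcd[m,n]∣n (suc k) T
  t′ = quotient d∣T

∃-prime-divisor : ∀ n → 2 ≤ n → ∃[ p ] (Prime p × p ∣ n)
∃-prime-divisor 1 (s≤s ())
∃-prime-divisor n@(suc (suc _)) _ with factorise n
... | record { factors = [] ; isFactorisation = () }
... | record { factors = p ∷ ps ; isFactorisation = n≡Πps ; factorsPrime = prime-p ∷ _ } =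
  p , prime-p , subst (p ∣_) (sym n≡Πps) (∈⇒∣product {ns = p ∷ ps} (here refl))

prime∣⇒∣rad : ∀ {p n} .{{_ : NonZero n}} → Prime p → p ∣ n → p ∣ rad n
prime∣⇒∣rad {p} {n} prime-p p∣n =
  ∈⇒∣product (∈-filter⁺ (λ q → prime? q ×-dec (q ∣? n)) (∈-upTo⁺ (s≤s (∣⇒≤ p∣n))) (prime-p , p∣n))

coprime-rad⇒coprime : ∀ {m n} .{{_ : NonZero n}} → Coprime m (rad n) → Coprime m n
coprime-rad⇒coprime {n = n} _ {zero} (_ , 0∣n) = contradiction (0∣⇒≡0 0∣n) (≢-nonZero⁻¹ n)
coprime-rad⇒coprime _ {suc zero} _ = refl
coprime-rad⇒coprime m⊥rad[n] {i@(suc (suc _))} (i∣m , i∣n)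
  with p , prime-p , p∣i ← ∃-prime-divisor i (s≤s (s≤s z≤n)) =
  contradiction (subst Prime (m⊥rad[n] (∣-trans p∣i i∣m , prime∣⇒∣rad prime-p (∣-trans p∣i i∣n))) prime-p) ¬prime[1]

coprime⇒*-∣-cancel : ∀ {c g r y} .{{_ : NonZero r}} → Coprime c g → r ∣ y → c * r ∣ g * y → c * r ∣ y
coprime⇒*-∣-cancel {c} {g} {r} c⊥g (divides u refl) cr∣gur =
  *-monoˡ-∣ r (coprime-divisor c⊥g (*-cancelʳ-∣ r (subst (c * r ∣_) (sym (*-assoc g u r)) cr∣gur)))

n*r∣m-b*r⇒r∣m : ∀ n r m b → (+ (n * r)) ℤ±.∣ (m - b ℤ.* + r) → (+ r) ℤ±.∣ m
n*r∣m-b*r⇒r∣m n r m b n*r∣m-b*r =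
  ℤ±.∣m+n∣n⇒∣m (ℤ±.∣-trans (ℤ±.∣ᵤ⇒∣ (n∣m*n n)) n*r∣m-b*r) (ℤ±.∣m⇒∣-m (ℤ±.∣n⇒∣m*n b ℤ±.∣-refl))

n*r∣c*r-b*r⇒n∣c-b : ∀ n r c b .{{_ : NonZero r}} →
  (+ (n * r)) ℤ±.∣ (+ (c * r) - b ℤ.* + r) → (+ n) ℤ±.∣ (+ c - b)
n*r∣c*r-b*r⇒n∣c-b n r c b n*r∣c*r-b*r = ℤ±.*-cancelʳ-∣ (+ r) (subst₂ ℤ±._∣_ (ℤ.pos-* n r) factor n*r∣c*r-b*r)
  where
  open ≡-Reasoning
  factor : + (c * r) - b ℤ.* + r ≡ (+ c - b) ℤ.* + r
  factor = begin
    + (c * r) - b ℤ.* + r               ≡⟨ cong₂ ℤ._+_ (ℤ.pos-* c r) (ℤ.neg-distribˡ-* b (+ r)) ⟩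
    + c ℤ.* + r ℤ.+ ℤ.- b ℤ.* + r       ≡⟨ ℤ.*-distribʳ-+ (+ r) (+ c) (ℤ.- b) ⟨
    (+ c - b) ℤ.* + r                   ∎

≡-mod⇒coprime : ∀ {n c} b → (+ n) ℤ±.∣ (+ c - b) → Coprime ∣ b ∣ n → Coprime c n
≡-mod⇒coprime {c = c} b n∣c-b b⊥n {i} (i∣c , i∣n) = b⊥n (ℤ±.∣⇒∣ᵤ i∣b , i∣n)
  where
  i∣b : (+ i) ℤ±.∣ b
  i∣b = subst ((+ i) ℤ±.∣_) (ℤ.neg-involutive b)
    (ℤ±.∣m⇒∣-m (ℤ±.∣m+n∣m⇒∣n (ℤ±.∣-trans (ℤ±.∣ᵤ⇒∣ i∣n) n∣c-b) (ℤ±.∣ᵤ⇒∣ {+ i} {+ c} i∣c)))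

congruent-multiple : ∀ n r r′ b .{{_ : NonZero r}} → (+ (n * r)) ℤ±.∣ (+ r′ - b ℤ.* + r) →
  Coprime ∣ b ∣ n → ∃[ c ] (r′ ≡ c * r × Coprime c n)
congruent-multiple n r r′ b n*r∣r′-b*r b⊥n
  with divides c refl ← ℤ±.∣⇒∣ᵤ (n*r∣m-b*r⇒r∣m n r (+ r′) b n*r∣r′-b*r) =
  c , refl , ≡-mod⇒coprime b (n*r∣c*r-b*r⇒n∣c-b n r c b n*r∣r′-b*r) b⊥n

distinguished-* : ∀ {s} (h : 2 ≤ s) t {r c} .{{_ : NonZero c}} →
  Coprime c s → Coprime c (gOf s h t) → Distinguished s h t r → Distinguished s h t (c * r)
distinguished-* {s} h t {r} {c} c⊥s c⊥g (2≤r , r⊥s , m , ord-m , r∣tq) = 2≤cr , cr⊥s , m′ , ord-m′ , cr∣tq′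
  where
  instance
    r≢0 = >-nonZero (<-trans z<s 2≤r)
    s≢0 = >-nonZero (<-trans z<s h)
    cr≢0 = m*n≢0 c r
  2≤cr : 2 ≤ c * r
  2≤cr = ≤-trans 2≤r (m≤n*m r c)
  cr⊥s : Coprime (c * r) s
  cr⊥s = Coprime.sym (coprime-* (Coprime.sym c⊥s) (Coprime.sym r⊥s))
  m′ : ℕ
  m′ = proj₁ (IsOrd-exists cr⊥s)
  ord-m′ : IsOrd (c * r) s m′
  ord-m′ = proj₂ (IsOrd-exists cr⊥s)
  cr∣s^m′∸1 : c * r ∣ s ^ m′ ∸ 1
  cr∣s^m′∸1 = proj₁ (proj₂ ord-m′)
  q∣q′ : repQuot s h m ∣ repQuot s h m′
  q∣q′ = repQuot-mono-∣ h {m} {m′} (IsOrd⇒∣ ord-m (∣-trans (n∣m*n c) cr∣s^m′∸1))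
  r∣tq′ : r ∣ ∣ t ∣ * repQuot s h m′
  r∣tq′ = ∣-trans (subst (r ∣_) (ℤ.abs-* t _) r∣tq) (*-monoʳ-∣ ∣ t ∣ q∣q′)
  cr∣tq′ : (+ (c * r)) ℤD.∣ (t ℤ.* + repQuot s h m′)
  cr∣tq′ = subst (c * r ∣_) (sym (ℤ.abs-* t _))
    (coprime⇒*-∣-cancel c⊥g r∣tq′ (∣-trans cr∣s^m′∸1 (s^n∸1∣gOf*[∣t∣*repQuot] h t m′)))

proposition3p6 : (s : ℕ) (h : 2 ≤ s) (t : ℤ) (r : ℕ) (b : ℤ) (r′ : ℕ) →
    Distinguished s h t r →
    Coprime ∣ b ∣ (rad (gOf s h t) * s) →
    1 ≤ r′ →
    (+ (rad (gOf s h t) * r * s)) ℤD.∣ ((+ r′) - b ℤ.* (+ r)) →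
    Distinguished s h t r′
proposition3p6 s h t r b r′ dist@(2≤r , _) b⊥Gs 1≤r′ Grs∣r′-br
  with c , refl , c⊥Gs ← congruent-multiple (rad (gOf s h t) * s) r r′ b {{>-nonZero (<-trans z<s 2≤r)}}
         (subst (λ n → (+ n) ℤ±.∣ (+ r′ - b ℤ.* + r)) (xy∙z≈xz∙y (rad (gOf s h t)) r s) (ℤ±.∣ᵤ⇒∣ Grs∣r′-br))
         b⊥Gs
  with c⊥G , c⊥s ← coprime-*⁻¹ {x = rad (gOf s h t)} {s} c⊥Gs
  = distinguished-* h t {{m*n≢0⇒m≢0 c {{>-nonZero 1≤r′}}}} c⊥s
      (coprime-rad⇒coprime {n = gOf s h t} {{gOf-nonZero h t}} c⊥G) dist
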